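{- Let $p$ be a prime and let $C$ and $D$ be self-orthogonal codes of length $k$ over $\mathbb{F}_p$. Suppose that $\operatorname{Aut}(L_A(D))$ acts transitively on the set of $A_{p-1}$-frames of $L_A(D)$. If $L_A(C)\cong L_A(D)$ as lattices, then $C\cong D$ as codes.
   Context: A code of length $k$ over $\mathbb{F}_p$ is a subspace of $\mathbb{F}_p^k$ with the standard dot product; self-orthogonal means $C\subset C^\perp$. Codes $C,D$ are isomorphic if $f(C)=D$ for some $f$ in the group generated by coordinate permutations and sign changes of single coordinates. $A_{n-1}=\{x\in\mathbb{Z}^n:\sum x_i=0\}$ with the standard inner product, $\varepsilon_1=e_1-\frac1n\sum_je_j$, $A_{n-1}^*/A_{n-1}=\langle\varepsilon_1+A_{n-1}\rangle\cong\mathbb{Z}/n$. Identify $\mathbb{F}_p^k$ with $(A_{p-1}^*/A_{p-1})^k$ via $a\mapsto(a_i\varepsilon_1+A_{p-1})_i$; $L_A(C)$ is the preimage of $C$ in $(A_{p-1}^*)^k$. For a lattice $L$, $L(2)=\{x\in L:(x,x)=2\}$, and $\operatorname{Aut}(L)$ is its group of isometries. For positive integers $n$, an $A_n$-frame of a lattice $L$ is a finite subset $F\subset L(2)$ which forms a root system of type $A_n^m$ (orthogonal sum of $m$ root systems of type $A_n$) for some $m$ with $\operatorname{rank}L=mn$. $\operatorname{Aut}(L)$ acts on the set of $A_n$-frames of $L$. -}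

module Defs where

open import Data.Nat using (ℕ; suc; _∸_) renaming (_*_ to _*ℕ_)
open import Data.Integer using (ℤ; +_; _+_; _-_; _*_; -_; 0ℤ; 1ℤ; -1ℤ)
open import Data.Integer.Divisibility using (_∣_)
open import Data.Fin using (Fin; zero; suc)
open import Data.Fin.Permutation using (Permutation′; _⟨$⟩ʳ_)
open import Data.Bool using (Bool; true; false; if_then_else_)
open import Data.Product using (Σ; _×_; _,_; ∃; ∃-syntax)
open import Relation.Binary.PropositionalEquality using (_≡_)
open import Relation.Nullary using (¬_; does)
open import Data.Fin using (_≟_)

sumFin : (n : ℕ) → (Fin n → ℤ) → ℤ
sumFin ℕ.zero    f = 0ℤ
sumFin (suc n) f = f zero + sumFin n (λ i → f (suc i))

_≡_[mod_] : ℤ → ℤ → ℕ → Set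
a ≡ b [mod p ] = (+ p) ∣ (a - b)

-- A word of F_p^k is represented by an integer vector Fin k → ℤ
-- (read modulo p).  A code of length k over F_p is a subspace of F_p^k,
-- i.e. a set of integer words which is closed under congruence mod p
-- (so it is really a subset of F_p^k), contains 0, and is closed under
-- addition and scalar multiplication.

Word : ℕ → Set
Word k = Fin k → ℤ

record Code (p k : ℕ) : Set₁ where
  field
    _∈C         : Word k → Set
    respects-mod : ∀ c c′ → (∀ i → c i ≡ c′ i [mod p ]) → c ∈C → c′ ∈C
    zero-mem    : (λ _ → 0ℤ) ∈C
    add-mem     : ∀ c d → c ∈C → d ∈C → (λ i → c i + d i) ∈C
    scal-mem    : ∀ (a : ℤ) c → c ∈C → (λ i → a * c i) ∈C
open Code public

wdot : (k : ℕ) → Word k → Word k → ℤ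
wdot k c d = sumFin k (λ i → c i * d i)

SelfOrthogonal : (p k : ℕ) → Code p k → Set
SelfOrthogonal p k C =
  ∀ c d → (C ∈C) c → (C ∈C) d → wdot k c d ≡ 0ℤ [mod p ]

sgn : Bool → ℤ
sgn true  = 1ℤ
sgn false = -1ℤ

monomial : (k : ℕ) → Permutation′ k → (Fin k → Bool) → Word k → Word k
monomial k σ s c = λ i → sgn (s i) * c (σ ⟨$⟩ʳ i)

-- C ≅ D as codes: f(C) = D for some f in the group generated by
-- coordinate permutations and single sign changes (= monomial ±1 maps).
CodeIso : (p k : ℕ) → Code p k → Code p k → Set
CodeIso p k C D =
  Σ (Permutation′ k) λ σ → Σ (Fin k → Bool) λ s →
    (∀ c → (C ∈C) c → (D ∈C) (monomial k σ s c)) ×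
    (∀ d → (D ∈C) d → ∃[ c ] ((C ∈C) c × (∀ i → monomial k σ s c i ≡ d i [mod p ])))

-- A vector of (A_{p-1}^*)^k ⊂ (ℚ^p)^k is represented by
-- p times its coordinates, an element of (ℤ^p)^k.  The true inner product
-- is  vdot / p².  An element x ∈ ℚ^p lies in A_{p-1}^* and has class
-- a·ε₁ + A_{p-1} iff  p·x ∈ ℤ^p, Σ (p·x)_j = 0 and every (p·x)_j ≡ -a
-- (mod p)  (since p·ε₁ = p e₁ - (1,…,1)).

Vect : ℕ → ℕ → Set
Vect p k = Fin k → Fin p → ℤ

vdot : (p k : ℕ) → Vect p k → Vect p k → ℤ
vdot p k v w = sumFin k (λ b → sumFin p (λ j → v b j * w b j))

_≈V_ : ∀ {p k} → Vect p k → Vect p k → Set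
v ≈V w = ∀ b j → v b j ≡ w b j

_+V_ : ∀ {p k} → Vect p k → Vect p k → Vect p k
(v +V w) b j = v b j + w b j

InLA : (p k : ℕ) → Code p k → Vect p k → Set
InLA p k C v =
  (∀ b → sumFin p (v b) ≡ 0ℤ) ×
  ∃[ c ] ((C ∈C) c × (∀ b j → v b j ≡ - c b [mod p ]))

-- a lattice isometry L_A(C) → L_A(D) (onto): a ℤ-linear map preserving the
-- inner product, mapping L_A(C) onto L_A(D).  (Values of f outside
-- L_A(C) are irrelevant.)
record LatIso (p k : ℕ) (C D : Code p k) : Set where
  field
    map      : Vect p k → Vect p k
    into     : ∀ v → InLA p k C v → InLA p k D (map v)
    additive : ∀ v w → InLA p k C v → InLA p k C w →
               map (v +V w) ≈V (map v +V map w)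
    isometry : ∀ v w → InLA p k C v → InLA p k C w →
               vdot p k (map v) (map w) ≡ vdot p k v w
    onto     : ∀ w → InLA p k D w → ∃[ v ] (InLA p k C v × map v ≈V w)
open LatIso public

Aut : (p k : ℕ) → Code p k → Set
Aut p k D = LatIso p k D D

-- A_{p-1}-frames.  rank L_A(D) = k(p-1), so an A_{p-1}-frame is a root
-- system of type A_{p-1}^k.  A subset F ⊂ L(2)
-- forms a root system of type A_{p-1}^k iff it is the image of an
-- inner-product-preserving bijection from the standard roots.

Root : ℕ → ℕ → Set
Root p k = Σ (Fin k) λ b → Σ (Fin p) λ i → Σ (Fin p) λ j → ¬ (i ≡ j)

δ : ∀ {n} → Fin n → Fin n → ℤ
δ i j = if does (i ≟ j) then 1ℤ else 0ℤ

stdRoot : (p k : ℕ) → Root p k → Vect p k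
stdRoot p k (b , i , j , _) b′ j′ = δ b b′ * (δ i j′ - δ j j′)

-- A frame is given by the parametrisation φ of the finite set F = image φ.
-- (φ is automatically injective and its image lies in L(2), since the
-- scaled inner product is p² times the standard one.)
record Frame (p k : ℕ) (D : Code p k) : Set where
  field
    φ     : Root p k → Vect p k
    inL   : ∀ r → InLA p k D (φ r)
    gram  : ∀ r s → vdot p k (φ r) (φ s) ≡ (+ (p *ℕ p)) * vdot p k (stdRoot p k r) (stdRoot p k s)
open Frame public

MapsFrameTo : (p k : ℕ) (D : Code p k) → Aut p k D → Frame p k D → Frame p k D → Set
MapsFrameTo p k D g F F′ =
  (∀ r → ∃[ s ] (map g (φ F r) ≈V φ F′ s)) ×
  (∀ s → ∃[ r ] (map g (φ F r) ≈V φ F′ s))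

FrameTransitive : (p k : ℕ) → Code p k → Set
FrameTransitive p k D =
  ∀ (F F′ : Frame p k D) → ∃[ g ] MapsFrameTo p k D g F F′

-- Composing a lattice isometry L_A(C) → L_A(D) with an automorphism of L_A(D), chosen by frame
-- transitivity, gives an isometry h carrying the standard frame {e_{b,i} − e_{b,j}} of L_A(C)
-- onto that of L_A(D), so h preserves the Gram matrix of roots. The roots e_{b,0} − e_{b,j}
-- (j ≠ 0) of a block b of D have pairwise inner product 1, hence their preimages form a star
-- ±(e_{τ b,π 0} − e_{τ b,π j}) inside one block τ b of C, with π a permutation. Pairing with
-- these roots and using that every block of a vector of L_A sums to zero shows that h acts on
-- coordinates as the signed permutation (h v)_{b,j} = ± v_{τ b,π j}; in particular τ is injective.
-- Reading the coordinate (h v)_{b,0} modulo p turns this into a monomial map C → D.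

module Submission where

open import Defs
open import Data.Nat using (ℕ; zero; suc; 2+) renaming (_*_ to _*ℕ_)
open import Data.Nat.Primality using (Prime)

import Data.Integer.Properties as ℤP
open import Algebra.Properties.CommutativeMonoid.Sum ℤP.+-0-commutativeMonoid using (sum; sum-permute)
open import Algebra.Properties.CommutativeSemigroup ℤP.*-commutativeSemigroup using (x∙yz≈y∙xz)
open import Data.Bool using (Bool; true; false)
open import Data.Fin using (Fin; zero; suc; punchOut; _≟_)
open import Data.Fin.Permutation using (Permutation′; _⟨$⟩ʳ_; _⟨$⟩ˡ_; permutation; inverseʳ)
open import Data.Fin.Properties using (any?; all?; ¬∀⟶∃¬; injective⇒≤; punchOut-injective)
open import Data.Integer using (ℤ; +_; _+_; _-_; _*_; -_; 0ℤ; 1ℤ; -1ℤ)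
import Data.Integer.Divisibility.Signed as Signed
open import Data.Integer.Tactic.RingSolver using (solve-∀)
import Data.Nat.Divisibility as ℕ
open import Data.Nat.Properties using (1+n≰n)
open import Data.Product using (Σ; _×_; _,_; ∃; proj₁; proj₂)
open import Data.Sum using (_⊎_; inj₁; inj₂)
open import Function using (_∘_)
open import Function.Definitions using (Injective)
open import Relation.Binary.PropositionalEquality
open import Relation.Nullary using (¬_; yes; no; contradiction)
open import Relation.Nullary.Decidable using (dec-true; dec-false)

open ≡-Reasoning

δ-refl : ∀ {n} (i : Fin n) → δ i i ≡ 1ℤ
δ-refl i rewrite dec-true (i ≟ i) refl = refl

δ-≢ : ∀ {n} {i j : Fin n} → i ≢ j → δ i j ≡ 0ℤ
δ-≢ {i = i} {j} i≢j rewrite dec-false (i ≟ j) i≢j = refl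

sumFin-cong : ∀ n {f g : Fin n → ℤ} → (∀ i → f i ≡ g i) → sumFin n f ≡ sumFin n g
sumFin-cong zero    f≗g = refl
sumFin-cong (suc n) f≗g = cong₂ _+_ (f≗g zero) (sumFin-cong n (f≗g ∘ suc))

sumFin-- : ∀ n (f g : Fin n → ℤ) → sumFin n (λ i → f i - g i) ≡ sumFin n f - sumFin n g
sumFin-- zero    f g = refl
sumFin-- (suc n) f g =
  trans (cong (_+_ (f zero - g zero)) (sumFin-- n (f ∘ suc) (g ∘ suc)))
        (interchange (f zero) (g zero) _ _)
  where
  interchange : ∀ a b c d → (a - b) + (c - d) ≡ (a + c) - (b + d)
  interchange = solve-∀

sumFin-*ˡ : ∀ n (a : ℤ) (f : Fin n → ℤ) → sumFin n (λ i → a * f i) ≡ a * sumFin n f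
sumFin-*ˡ zero    a f = sym (ℤP.*-zeroʳ a)
sumFin-*ˡ (suc n) a f =
  trans (cong (_+_ (a * f zero)) (sumFin-*ˡ n a (f ∘ suc))) (sym (ℤP.*-distribˡ-+ a _ _))

sumFin-const : ∀ n (a : ℤ) → sumFin n (λ _ → a) ≡ + n * a
sumFin-const zero    a = refl
sumFin-const (suc n) a = trans (cong (_+_ a) (sumFin-const n a)) (sym (ℤP.suc-* (+ n) a))

sumFin-δ : ∀ n (i : Fin n) (f : Fin n → ℤ) → sumFin n (λ j → δ i j * f j) ≡ f i
sumFin-δ (suc n) zero    f =
  trans (cong₂ _+_ (ℤP.*-identityˡ (f zero)) (trans (sumFin-const n 0ℤ) (ℤP.*-zeroʳ (+ n))))
        (ℤP.+-identityʳ (f zero))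
sumFin-δ (suc n) (suc i) f = trans (ℤP.+-identityˡ _) (sumFin-δ n i (f ∘ suc))

sumFin≡sum : ∀ n (f : Fin n → ℤ) → sumFin n f ≡ sum f
sumFin≡sum zero    f = refl
sumFin≡sum (suc n) f = cong (_+_ (f zero)) (sumFin≡sum n (f ∘ suc))

sumFin-permute : ∀ n (π : Permutation′ n) (f : Fin n → ℤ) → sumFin n (f ∘ (π ⟨$⟩ʳ_)) ≡ sumFin n f
sumFin-permute n π f = begin
  sumFin n (f ∘ (π ⟨$⟩ʳ_)) ≡⟨ sumFin≡sum n _ ⟩
  sum (f ∘ (π ⟨$⟩ʳ_))      ≡⟨ sum-permute f π ⟨
  sum f                    ≡⟨ sumFin≡sum n f ⟨
  sumFin n f               ∎

sumFin-differences : ∀ n (f : Fin n → ℤ) (i : Fin n) → sumFin n f ≡ 0ℤ →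
                     sumFin n (λ j → f i - f j) ≡ + n * f i
sumFin-differences n f i Σf≡0 = begin
  sumFin n (λ j → f i - f j)       ≡⟨ sumFin-- n (λ _ → f i) f ⟩
  sumFin n (λ _ → f i) - sumFin n f ≡⟨ cong₂ _-_ (sumFin-const n (f i)) Σf≡0 ⟩
  + n * f i - 0ℤ                   ≡⟨ ℤP.+-identityʳ _ ⟩
  + n * f i                        ∎

injective⇒surjective : ∀ {n} {f : Fin n → Fin n} → Injective _≡_ _≡_ f → ∀ i → ∃ λ j → f j ≡ i
injective⇒surjective {suc n} {f} f-inj i with any? (λ j → f j ≟ i)
... | yes hit = hit
... | no miss = contradiction (injective⇒≤ punchOut∘f-injective) 1+n≰n
  where
  i≢f : ∀ j → i ≢ f j
  i≢f j i≡fj = miss (j , sym i≡fj)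

  punchOut∘f-injective : Injective _≡_ _≡_ (λ j → punchOut (i≢f j))
  punchOut∘f-injective eq = f-inj (punchOut-injective (i≢f _) (i≢f _) eq)

injective⇒permutation : ∀ {n} (f : Fin n → Fin n) → Injective _≡_ _≡_ f → Permutation′ n
injective⇒permutation f f-inj =
  permutation f (proj₁ ∘ surj) (proj₂ ∘ surj) (λ i → f-inj (proj₂ (surj (f i))))
  where
  surj : ∀ i → ∃ λ j → f j ≡ i
  surj = injective⇒surjective f-inj

≡-mod-multiple : ∀ {a b : ℤ} {m : ℕ} (c : ℤ) → a - b ≡ c * + m → a ≡ b [mod m ]
≡-mod-multiple c eq = Signed.∣⇒∣ᵤ (Signed.divides c eq)

≡-mod-sym : ∀ {a b : ℤ} {m : ℕ} → a ≡ b [mod m ] → b ≡ a [mod m ]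
≡-mod-sym {a} {b} {m} = subst (m ℕ.∣_) (ℤP.∣i-j∣≡∣j-i∣ a b)

≡-mod-rescale : ∀ {x y a b : ℤ} {m : ℕ} (e : ℤ) →
                x ≡ - a [mod m ] → y ≡ - b [mod m ] → x ≡ e * y → a ≡ e * b [mod m ]
≡-mod-rescale {x} {y} {a} {b} {m} e x≡-a y≡-b x≡ey =
  Signed.∣⇒∣ᵤ (subst (+ m Signed.∣_) difference
    (Signed.∣m∣n⇒∣m-n (Signed.∣ᵤ⇒∣ {i = x - - a} x≡-a)
                      (Signed.∣n⇒∣m*n e (Signed.∣ᵤ⇒∣ {i = y - - b} y≡-b))))
  where
  rearrange : ∀ e y a b → (e * y - - a) - e * (y - - b) ≡ a - e * b
  rearrange = solve-∀

  difference : (x - - a) - e * (y - - b) ≡ a - e * b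
  difference = trans (cong (λ z → (z - - a) - e * (y - - b)) x≡ey) (rearrange e y a b)

-- An arc (i , j , _) stands for the root e_i − e_j of A_{n−1}; a root of Defs is a block index
-- paired with an arc.
Arc : ℕ → Set
Arc n = Σ (Fin n) λ i → Σ (Fin n) λ j → ¬ i ≡ j

src tgt : ∀ {n} → Arc n → Fin n
src = proj₁
tgt = proj₁ ∘ proj₂

src≢tgt : ∀ {n} (α : Arc n) → src α ≢ tgt α
src≢tgt = proj₂ ∘ proj₂

orient : ∀ {n} → Bool → Arc n → Arc n
orient true  α             = α
orient false (i , j , i≢j) = j , i , i≢j ∘ sym

arcVec : ∀ {n} → Arc n → Fin n → ℤ
arcVec (i , j , _) l = δ i l - δ j l

arcDot : ∀ {n} → Arc n → Arc n → ℤ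
arcDot α β = arcVec α (src β) - arcVec α (tgt β)

difference-orient : ∀ {n} (y : Fin n → ℤ) (ε : Bool) (α : Arc n) →
                    y (src α) - y (tgt α) ≡ sgn ε * (y (src (orient ε α)) - y (tgt (orient ε α)))
difference-orient y true  α = sym (ℤP.*-identityˡ _)
difference-orient y false α = flip (y (src α)) (y (tgt α))
  where
  flip : ∀ a c → a - c ≡ -1ℤ * (c - a)
  flip = solve-∀

orient-sameEnds : ∀ {n} ε (α β : Arc n) →
                  src (orient ε α) ≡ src (orient ε β) → tgt (orient ε α) ≡ tgt (orient ε β) →
                  src α ≡ src β × tgt α ≡ tgt β
orient-sameEnds true  α β s t = s , t
orient-sameEnds false α β s t = t , s

arcDot-sameEnds : ∀ {n} (α β : Arc n) → src α ≡ src β → tgt α ≡ tgt β → arcDot α β ≡ + 2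
arcDot-sameEnds (i , j , i≢j) (.i , .j , _) refl refl
  rewrite δ-refl i | δ-refl j | δ-≢ i≢j | δ-≢ (i≢j ∘ sym) = refl

arcDot≡1⇒shareEnd : ∀ {n} (α β : Arc n) → arcDot α β ≡ 1ℤ → src α ≡ src β ⊎ tgt α ≡ tgt β
arcDot≡1⇒shareEnd (i , j , _) (i′ , j′ , _) with i ≟ i′ | j ≟ j′ | j ≟ i′ | i ≟ j′
... | yes i≡i′ | _        | _     | _     = λ _ → inj₁ i≡i′
... | no _     | yes j≡j′ | _     | _     = λ _ → inj₂ j≡j′
... | no _     | no _     | yes _ | yes _ = λ ()
... | no _     | no _     | yes _ | no _  = λ ()
... | no _     | no _     | no _  | yes _ = λ ()
... | no _     | no _     | no _  | no _  = λ ()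

record Star {n m} (t : Fin m → Arc n) : Set where
  field
    sign    : Bool
    hub     : Fin n
    src-hub : ∀ j → src (orient sign (t j)) ≡ hub

  points : Fin (suc m) → Fin n
  points zero    = hub
  points (suc j) = tgt (orient sign (t j))

module PairwiseUnitDot {n m} (t : Fin (suc m) → Arc n)
               (unitDot : ∀ {l j} → l ≢ j → arcDot (t l) (t j) ≡ 1ℤ) where

  shareEnd₀ : ∀ j → src (t j) ≡ src (t zero) ⊎ tgt (t j) ≡ tgt (t zero)
  shareEnd₀ j with j ≟ zero
  ... | yes refl = inj₁ refl
  ... | no j≢0   = arcDot≡1⇒shareEnd (t j) (t zero) (unitDot j≢0)

  -- If t l avoids src (t zero), an arc t j through src (t zero) but not tgt (t zero) would share
  -- no end with t l.
  tgt-shared : ∀ l → src (t l) ≢ src (t zero) → ∀ j → tgt (t j) ≡ tgt (t zero)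
  tgt-shared l l-off j with shareEnd₀ j | shareEnd₀ l
  ... | inj₂ tj≡t₀ | _          = tj≡t₀
  ... | inj₁ _     | inj₁ sl≡s₀ = contradiction sl≡s₀ l-off
  ... | inj₁ sj≡s₀ | inj₂ tl≡t₀
    with arcDot≡1⇒shareEnd (t j) (t l) (unitDot λ { refl → l-off sj≡s₀ })
  ...   | inj₁ sj≡sl = contradiction (trans (sym sj≡sl) sj≡s₀) l-off
  ...   | inj₂ tj≡tl = trans tj≡tl tl≡t₀

  star : Star t
  star with all? (λ j → src (t j) ≟ src (t zero))
  ... | yes all-src = record { sign = true ; hub = src (t zero) ; src-hub = all-src }
  ... | no ¬all-src =
    let l , l-off = ¬∀⟶∃¬ _ _ (λ j → src (t j) ≟ src (t zero)) ¬all-src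
    in  record { sign = false ; hub = tgt (t zero) ; src-hub = tgt-shared l l-off }

  points-injective : (S : Star t) → Injective _≡_ _≡_ (Star.points S)
  points-injective S {zero}  {zero}  _ = refl
  points-injective S {zero}  {suc j} e =
    contradiction (trans (src-hub j) e) (src≢tgt (orient sign (t j)))
    where open Star S
  points-injective S {suc j} {zero}  e =
    contradiction (trans (src-hub j) (sym e)) (src≢tgt (orient sign (t j)))
    where open Star S
  points-injective S {suc j} {suc l} e with j ≟ l
  ... | yes j≡l = cong suc j≡l
  ... | no j≢l  =
    contradiction (trans (sym (unitDot j≢l)) (arcDot-sameEnds (t j) (t l) (proj₁ ends) (proj₂ ends)))
                  λ ()
    where
    open Star S
    ends : src (t j) ≡ src (t l) × tgt (t j) ≡ tgt (t l)
    ends = orient-sameEnds sign (t j) (t l) (trans (src-hub j) (sym (src-hub l))) e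

ZeroRowSums : ∀ {p k} → Vect p k → Set
ZeroRowSums {p} v = ∀ b → sumFin p (v b) ≡ 0ℤ

-- Transports pre v x holds when x = h v for an isometry h with h (ρ (pre s)) = ρ s for every
-- root s (ρ = stdRoot); it is all the argument uses of such an h.
Transports : ∀ {p k} → (Root p k → Root p k) → Vect p k → Vect p k → Set
Transports {p} {k} pre v x = ∀ s → vdot p k x (stdRoot p k s) ≡ vdot p k v (stdRoot p k (pre s))

vdot-cong : ∀ {p k} {x x′ y y′ : Vect p k} → x ≈V x′ → y ≈V y′ → vdot p k x y ≡ vdot p k x′ y′
vdot-cong {p} {k} x≈x′ y≈y′ = sumFin-cong k λ b → sumFin-cong p λ j → cong₂ _*_ (x≈x′ b j) (y≈y′ b j)

vdot-factor : ∀ {p k} (a : ℤ) (x y x′ y′ : Vect p k) →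
              (∀ b j → x b j * y b j ≡ a * (x′ b j * y′ b j)) → vdot p k x y ≡ a * vdot p k x′ y′
vdot-factor {p} {k} a x y x′ y′ eq =
  trans (sumFin-cong k λ b → trans (sumFin-cong p (eq b)) (sumFin-*ˡ p a _)) (sumFin-*ˡ k a _)

vdot-scaleˡ : ∀ {p k} (a : ℤ) (x y : Vect p k) → vdot p k (λ b j → a * x b j) y ≡ a * vdot p k x y
vdot-scaleˡ a x y = vdot-factor a (λ b j → a * x b j) y x y λ b j → ℤP.*-assoc a (x b j) (y b j)

vdot-scaleʳ : ∀ {p k} (a : ℤ) (x y : Vect p k) → vdot p k x (λ b j → a * y b j) ≡ a * vdot p k x y
vdot-scaleʳ a x y = vdot-factor a x (λ b j → a * y b j) x y λ b j → x∙yz≈y∙xz (x b j) a (y b j)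

vdot-stdRoot : ∀ {p k} (y : Vect p k) (r : Root p k) →
               vdot p k y (stdRoot p k r) ≡ y (proj₁ r) (src (proj₂ r)) - y (proj₁ r) (tgt (proj₂ r))
vdot-stdRoot {p} {k} y (b , i , j , _) =
  trans (sumFin-cong k row) (sumFin-δ k b λ b′ → y b′ i - y b′ j)
  where
  expand : ∀ y d e e′ → y * (d * (e - e′)) ≡ d * (e * y - e′ * y)
  expand = solve-∀

  row : ∀ b′ → sumFin p (λ l → y b′ l * (δ b b′ * (δ i l - δ j l))) ≡ δ b b′ * (y b′ i - y b′ j)
  row b′ = begin
    sumFin p (λ l → y b′ l * (δ b b′ * (δ i l - δ j l)))
      ≡⟨ sumFin-cong p (λ l → expand (y b′ l) (δ b b′) (δ i l) (δ j l)) ⟩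
    sumFin p (λ l → δ b b′ * (δ i l * y b′ l - δ j l * y b′ l)) ≡⟨ sumFin-*ˡ p (δ b b′) _ ⟩
    δ b b′ * sumFin p (λ l → δ i l * y b′ l - δ j l * y b′ l)   ≡⟨ cong (δ b b′ *_) (sumFin-- p _ _) ⟩
    δ b b′ * (sumFin p (λ l → δ i l * y b′ l) - sumFin p (λ l → δ j l * y b′ l))
      ≡⟨ cong (δ b b′ *_) (cong₂ _-_ (sumFin-δ p i (y b′)) (sumFin-δ p j (y b′))) ⟩
    δ b b′ * (y b′ i - y b′ j)                                  ∎

vdot-stdRoot-stdRoot : ∀ {p k} (b b′ : Fin k) (α β : Arc p) →
                       vdot p k (stdRoot p k (b , α)) (stdRoot p k (b′ , β)) ≡ δ b b′ * arcDot α β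
vdot-stdRoot-stdRoot b b′ α β =
  trans (vdot-stdRoot (stdRoot _ _ (b , α)) (b′ , β))
        (distrib (δ b b′) (arcVec α (src β)) (arcVec α (tgt β)))
  where
  distrib : ∀ d u w → d * u - d * w ≡ d * (u - w)
  distrib = solve-∀

vdot-stdRoot-sameBlock : ∀ {p k} {b b′ : Fin k} (α β : Arc p) → b ≡ b′ →
                         vdot p k (stdRoot p k (b , α)) (stdRoot p k (b′ , β)) ≡ arcDot α β
vdot-stdRoot-sameBlock {b = b} α β refl =
  trans (vdot-stdRoot-stdRoot b b α β) (trans (cong (_* arcDot α β) (δ-refl b)) (ℤP.*-identityˡ _))

vdot-stdRoot≢0⇒sameBlock : ∀ {p k} (r s : Root p k) →
                           vdot p k (stdRoot p k r) (stdRoot p k s) ≢ 0ℤ → proj₁ r ≡ proj₁ s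
vdot-stdRoot≢0⇒sameBlock (b , α) (b′ , β) nonzero with b ≟ b′
... | yes b≡b′ = b≡b′
... | no b≢b′  =
  contradiction (trans (vdot-stdRoot-stdRoot b b′ α β) (cong (_* arcDot α β) (δ-≢ b≢b′))) nonzero

stdRoot-rowSums : ∀ {p k} (r : Root p k) → ZeroRowSums (stdRoot p k r)
stdRoot-rowSums {p} (b , i , j , _) b′ = begin
  sumFin p (λ l → δ b b′ * (δ i l - δ j l))  ≡⟨ sumFin-*ˡ p (δ b b′) _ ⟩
  δ b b′ * sumFin p (λ l → δ i l - δ j l)    ≡⟨ cong (δ b b′ *_) (sumFin-- p (δ i) (δ j)) ⟩
  δ b b′ * (sumFin p (δ i) - sumFin p (δ j)) ≡⟨ cong (δ b b′ *_) (cong₂ _-_ (sumδ i) (sumδ j)) ⟩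
  δ b b′ * (1ℤ - 1ℤ)                         ≡⟨ ℤP.*-zeroʳ (δ b b′) ⟩
  0ℤ                                         ∎
  where
  sumδ : ∀ i → sumFin p (δ i) ≡ 1ℤ
  sumδ i = trans (sumFin-cong p λ l → sym (ℤP.*-identityʳ (δ i l))) (sumFin-δ p i (λ _ → 1ℤ))

stdRoot-src : ∀ {p k} (r : Root p k) → stdRoot p k r (proj₁ r) (src (proj₂ r)) ≡ 1ℤ
stdRoot-src (b , i , j , i≢j) rewrite δ-refl b | δ-refl i | δ-≢ (i≢j ∘ sym) = refl

stdRoot-offBlock : ∀ {p k} (r : Root p k) {b′ : Fin k} (j : Fin p) →
                   proj₁ r ≢ b′ → stdRoot p k r b′ j ≡ 0ℤ
stdRoot-offBlock r j b≢b′ rewrite δ-≢ b≢b′ = refl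

module RootMatching {q k : ℕ} (pre : Root (2+ q) k → Root (2+ q) k)
       (transports-roots : ∀ s → Transports pre (stdRoot (2+ q) k (pre s)) (stdRoot (2+ q) k s)) where

  private
    p : ℕ
    p = 2+ q

    ρ : Root p k → Vect p k
    ρ = stdRoot p k

  spoke : Fin k → Fin (suc q) → Root p k
  spoke b j = b , zero , suc j , λ ()

  image : Fin k → Fin (suc q) → Root p k
  image b = pre ∘ spoke b

  imageArc : Fin k → Fin (suc q) → Arc p
  imageArc b = proj₂ ∘ image b

  τ : Fin k → Fin k
  τ b = proj₁ (image b zero)

  image-dot : ∀ b {l j} → l ≢ j → vdot p k (ρ (image b l)) (ρ (image b j)) ≡ 1ℤ
  image-dot b {l} {j} l≢j = begin
    vdot p k (ρ (image b l)) (ρ (image b j))       ≡⟨ transports-roots (spoke b l) (spoke b j) ⟨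
    vdot p k (ρ (spoke b l)) (ρ (spoke b j))
      ≡⟨ vdot-stdRoot-sameBlock {b = b} (proj₂ (spoke b l)) (proj₂ (spoke b j)) refl ⟩
    arcDot (proj₂ (spoke b l)) (proj₂ (spoke b j)) ≡⟨ spokes-dot ⟩
    1ℤ                                             ∎
    where
    spokes-dot : arcDot (proj₂ (spoke b l)) (proj₂ (spoke b j)) ≡ 1ℤ
    spokes-dot rewrite δ-≢ l≢j = refl

  image-block : ∀ b j → proj₁ (image b j) ≡ τ b
  image-block b j with j ≟ zero
  ... | yes refl = refl
  ... | no j≢0   = vdot-stdRoot≢0⇒sameBlock (image b j) (image b zero)
                     λ dot≡0 → contradiction (trans (sym (image-dot b j≢0)) dot≡0) λ ()

  imageArc-dot : ∀ b {l j} → l ≢ j → arcDot (imageArc b l) (imageArc b j) ≡ 1ℤ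
  imageArc-dot b {l} {j} l≢j =
    trans (sym (vdot-stdRoot-sameBlock (imageArc b l) (imageArc b j)
                  (trans (image-block b l) (sym (image-block b j)))))
          (image-dot b l≢j)

  star : ∀ b → Star (imageArc b)
  star b = PairwiseUnitDot.star (imageArc b) (imageArc-dot b)

  sign : Fin k → Bool
  sign b = Star.sign (star b)

  π : Fin k → Permutation′ p
  π b = injective⇒permutation (Star.points (star b))
          (PairwiseUnitDot.points-injective (imageArc b) (imageArc-dot b) (star b))

  spoke-differences : ∀ {v x} → Transports pre v x → ∀ b j →
                      x b zero - x b j ≡ sgn (sign b) * (v (τ b) (π b ⟨$⟩ʳ zero) - v (τ b) (π b ⟨$⟩ʳ j))
  spoke-differences {v} {x} tr b zero = begin
    x b zero - x b zero  ≡⟨ ℤP.+-inverseʳ (x b zero) ⟩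
    0ℤ                   ≡⟨ ℤP.*-zeroʳ (sgn (sign b)) ⟨
    sgn (sign b) * 0ℤ    ≡⟨ cong (sgn (sign b) *_) (ℤP.+-inverseʳ (v (τ b) (π b ⟨$⟩ʳ zero))) ⟨
    sgn (sign b) * (v (τ b) (π b ⟨$⟩ʳ zero) - v (τ b) (π b ⟨$⟩ʳ zero)) ∎
  spoke-differences {v} {x} tr b (suc j) = begin
    x b zero - x b (suc j)                 ≡⟨ vdot-stdRoot x (spoke b j) ⟨
    vdot p k x (ρ (spoke b j))             ≡⟨ tr (spoke b j) ⟩
    vdot p k v (ρ (image b j))             ≡⟨ vdot-stdRoot v (image b j) ⟩
    v b′ (src α) - v b′ (tgt α)            ≡⟨ difference-orient (v b′) ε α ⟩
    sgn ε * (v b′ (src (orient ε α)) - v b′ (tgt (orient ε α)))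
      ≡⟨ cong₂ (λ c h → sgn ε * (v c h - v c (tgt (orient ε α))))
               (image-block b j) (Star.src-hub (star b) j) ⟩
    sgn ε * (v (τ b) (Star.hub (star b)) - v (τ b) (tgt (orient ε α))) ∎
    where
    b′ : Fin k
    b′ = proj₁ (image b j)

    α : Arc p
    α = imageArc b j

    ε : Bool
    ε = sign b

  transports⇒monomial : ∀ {v x} → ZeroRowSums v → ZeroRowSums x → Transports pre v x →
                        ∀ b j → x b j ≡ sgn (sign b) * v (τ b) (π b ⟨$⟩ʳ j)
  transports⇒monomial {v} {x} v-rows x-rows tr b j = begin
    x b j                               ≡⟨ rearrange (x b zero) (x b j) ⟩
    x b zero - (x b zero - x b j)       ≡⟨ cong₂ _-_ hub-coordinate (spoke-differences {v} {x} tr b j) ⟩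
    e * w zero - e * (w zero - w j)     ≡⟨ cancel e (w zero) (w j) ⟩
    e * w j                             ∎
    where
    e : ℤ
    e = sgn (sign b)

    w : Fin p → ℤ
    w i = v (τ b) (π b ⟨$⟩ʳ i)

    rearrange : ∀ a c → c ≡ a - (a - c)
    rearrange = solve-∀

    cancel : ∀ e a c → e * a - e * (a - c) ≡ e * c
    cancel = solve-∀

    w-sum : sumFin p w ≡ 0ℤ
    w-sum = trans (sumFin-permute p (π b) (v (τ b))) (v-rows (τ b))

    hub-coordinate : x b zero ≡ e * w zero
    hub-coordinate = ℤP.*-cancelˡ-≡ (+ p) _ _ (begin
      + p * x b zero                      ≡⟨ sumFin-differences p (x b) zero (x-rows b) ⟨
      sumFin p (λ i → x b zero - x b i)   ≡⟨ sumFin-cong p (spoke-differences {v} {x} tr b) ⟩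
      sumFin p (λ i → e * (w zero - w i)) ≡⟨ sumFin-*ˡ p e (λ i → w zero - w i) ⟩
      e * sumFin p (λ i → w zero - w i)   ≡⟨ cong (e *_) (sumFin-differences p w zero w-sum) ⟩
      e * (+ p * w zero)                  ≡⟨ x∙yz≈y∙xz e (+ p) (w zero) ⟩
      + p * (e * w zero)                  ∎)

  -- Take s a root of block b₂ and r = pre s, so h (ρ r) = ρ s: block b₁ of ρ s vanishes, while the
  -- monomial formula reads it off block τ b₁ = τ b₂ of ρ r, which contains the entry 1.
  τ-injective : Injective _≡_ _≡_ τ
  τ-injective {b₁} {b₂} τb₁≡τb₂ with b₁ ≟ b₂
  ... | yes b₁≡b₂ = b₁≡b₂
  ... | no b₁≢b₂  = contradiction zero≡sign (sgn≢0 (sign b₁))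
    where
    s r : Root p k
    s = spoke b₂ zero
    r = pre s

    j : Fin p
    j = π b₁ ⟨$⟩ˡ src (proj₂ r)

    sgn≢0 : ∀ ε → 0ℤ ≢ sgn ε
    sgn≢0 true  ()
    sgn≢0 false ()

    zero≡sign : 0ℤ ≡ sgn (sign b₁)
    zero≡sign = begin
      0ℤ
        ≡⟨ stdRoot-offBlock s j (b₁≢b₂ ∘ sym) ⟨
      ρ s b₁ j
        ≡⟨ transports⇒monomial {ρ r} {ρ s} (stdRoot-rowSums r) (stdRoot-rowSums s)
                                (transports-roots s) b₁ j ⟩
      sgn (sign b₁) * ρ r (τ b₁) (π b₁ ⟨$⟩ʳ j)
        ≡⟨ cong₂ (λ c i → sgn (sign b₁) * ρ r c i) τb₁≡τb₂ (inverseʳ (π b₁)) ⟩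
      sgn (sign b₁) * ρ r (proj₁ r) (src (proj₂ r))
        ≡⟨ cong (sgn (sign b₁) *_) (stdRoot-src r) ⟩
      sgn (sign b₁) * 1ℤ
        ≡⟨ ℤP.*-identityʳ _ ⟩
      sgn (sign b₁)
        ∎

scaledRoot : ∀ {p k} → Root p k → Vect p k
scaledRoot {p} {k} r b j = + p * stdRoot p k r b j

scaledRoot∈LA : ∀ {p k} (E : Code p k) (r : Root p k) → InLA p k E (scaledRoot r)
scaledRoot∈LA {p} {k} E r =
  (λ b → trans (sumFin-*ˡ p (+ p) (stdRoot p k r b))
               (trans (cong (+ p *_) (stdRoot-rowSums r b)) (ℤP.*-zeroʳ (+ p)))) ,
  (λ _ → 0ℤ) , zero-mem E ,
  λ b j → ≡-mod-multiple {a = scaledRoot r b j} {b = - 0ℤ} (stdRoot p k r b j) (commute (+ p) _)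
  where
  commute : ∀ a x → a * x - - 0ℤ ≡ x * a
  commute = solve-∀

scaledRoot-gram : ∀ {p k} (r s : Root p k) →
                  vdot p k (scaledRoot r) (scaledRoot s)
                    ≡ + (p *ℕ p) * vdot p k (stdRoot p k r) (stdRoot p k s)
scaledRoot-gram {p} {k} r s = begin
  vdot p k (scaledRoot r) (scaledRoot s)   ≡⟨ vdot-scaleˡ (+ p) ρr (scaledRoot s) ⟩
  + p * vdot p k ρr (scaledRoot s)         ≡⟨ cong (+ p *_) (vdot-scaleʳ (+ p) ρr ρs) ⟩
  + p * (+ p * vdot p k ρr ρs)             ≡⟨ ℤP.*-assoc (+ p) (+ p) _ ⟨
  + p * + p * vdot p k ρr ρs               ≡⟨ cong (_* vdot p k ρr ρs) (ℤP.pos-* p p) ⟨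
  + (p *ℕ p) * vdot p k ρr ρs              ∎
  where
  ρr ρs : Vect p k
  ρr = stdRoot p k r
  ρs = stdRoot p k s

standardFrame : ∀ {p k} (E : Code p k) → Frame p k E
standardFrame E = record { φ = scaledRoot ; inL = scaledRoot∈LA E ; gram = scaledRoot-gram }

imageFrame : ∀ {p k} {C D : Code p k} → LatIso p k C D → Frame p k D
imageFrame {C = C} f = record
  { φ    = map f ∘ scaledRoot
  ; inL  = λ r → into f _ (scaledRoot∈LA C r)
  ; gram = λ r s → trans (isometry f _ _ (scaledRoot∈LA C r) (scaledRoot∈LA C s)) (scaledRoot-gram r s)
  }

-- The vector (c_b ε₁)_b of L_A in p-scaled coordinates, using p ε₁ = p e₁ − (1, …, 1).
lift : ∀ {m k} → Word k → Vect (suc m) k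
lift {m} c b j = δ zero j * (+ suc m * c b) - c b

lift∈LA : ∀ {m k} (E : Code (suc m) k) {c : Word k} → (E ∈C) c → InLA (suc m) k E (lift c)
lift∈LA {m} E {c} c∈E =
  rows , c , c∈E ,
  λ b j → ≡-mod-multiple {a = lift {m} c b j} {b = - c b} (δ zero j * c b)
                          (regroup (δ zero j) (+ suc m) (c b))
  where
  regroup : ∀ d a x → (d * (a * x) - x) - - x ≡ (d * x) * a
  regroup = solve-∀

  rows : ZeroRowSums (lift {m} c)
  rows b = begin
    sumFin (suc m) (λ j → δ zero j * (+ suc m * c b) - c b)
      ≡⟨ sumFin-- (suc m) (λ j → δ zero j * (+ suc m * c b)) (λ _ → c b) ⟩
    sumFin (suc m) (λ j → δ zero j * (+ suc m * c b)) - sumFin (suc m) (λ _ → c b)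
      ≡⟨ cong₂ _-_ (sumFin-δ (suc m) zero (λ _ → + suc m * c b)) (sumFin-const (suc m) (c b)) ⟩
    + suc m * c b - + suc m * c b
      ≡⟨ ℤP.+-inverseʳ (+ suc m * c b) ⟩
    0ℤ ∎

codeword : ∀ {p k} (E : Code p k) (v : Vect p k) → InLA p k E v → Word k
codeword E v = proj₁ ∘ proj₂

codeword∈ : ∀ {p k} (E : Code p k) (v : Vect p k) (v∈ : InLA p k E v) → (E ∈C) (codeword E v v∈)
codeword∈ E v = proj₁ ∘ proj₂ ∘ proj₂

module Matching {q k : ℕ} {C D : Code (2+ q) k} (f : LatIso (2+ q) k C D) (g : Aut (2+ q) k D)
       (pre : Root (2+ q) k → Root (2+ q) k)
       (g∘f-pre : ∀ s → map g (map f (scaledRoot (pre s))) ≈V scaledRoot s) where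

  private
    p : ℕ
    p = 2+ q

    ρ : Root p k → Vect p k
    ρ = stdRoot p k

  transports : ∀ v u w → InLA p k C v → InLA p k D u → u ≈V map f v → w ≈V map g u →
               Transports pre v w
  transports v u w v∈ u∈ u≈fv w≈gu s = ℤP.*-cancelˡ-≡ (+ p) _ _ (begin
    + p * vdot p k w (ρ s)             ≡⟨ vdot-scaleʳ (+ p) w (ρ s) ⟨
    vdot p k w (scaledRoot s)          ≡⟨ vdot-cong w≈gu (λ b j → sym (g∘f-pre s b j)) ⟩
    vdot p k (map g u) (map g (map f r)) ≡⟨ isometry g u (map f r) u∈ (into f r r∈) ⟩
    vdot p k u (map f r)               ≡⟨ vdot-cong {y = map f r} u≈fv (λ _ _ → refl) ⟩
    vdot p k (map f v) (map f r)       ≡⟨ isometry f v r v∈ r∈ ⟩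
    vdot p k v r                       ≡⟨ vdot-scaleʳ (+ p) v (ρ (pre s)) ⟩
    + p * vdot p k v (ρ (pre s))       ∎)
    where
    r : Vect p k
    r = scaledRoot (pre s)

    r∈ : InLA p k C r
    r∈ = scaledRoot∈LA C (pre s)

  transports-roots : ∀ s → Transports pre (ρ (pre s)) (ρ s)
  transports-roots s t = ℤP.*-cancelˡ-≡ (+ p) _ _ (begin
    + p * vdot p k (ρ s) (ρ t)                ≡⟨ vdot-scaleˡ (+ p) (ρ s) (ρ t) ⟨
    vdot p k (scaledRoot s) (ρ t)             ≡⟨ transports r (map f r) (scaledRoot s) r∈ (into f r r∈)
                                                   (λ _ _ → refl) (λ b j → sym (g∘f-pre s b j)) t ⟩
    vdot p k (scaledRoot (pre s)) (ρ (pre t)) ≡⟨ vdot-scaleˡ (+ p) (ρ (pre s)) (ρ (pre t)) ⟩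
    + p * vdot p k (ρ (pre s)) (ρ (pre t))    ∎)
    where
    r : Vect p k
    r = scaledRoot (pre s)

    r∈ : InLA p k C r
    r∈ = scaledRoot∈LA C (pre s)

  open RootMatching pre transports-roots

  σ : Permutation′ k
  σ = injective⇒permutation τ τ-injective

  codeword-monomial : ∀ v w (v∈ : InLA p k C v) (w∈ : InLA p k D w) → Transports pre v w →
                      ∀ b → codeword D w w∈ b ≡ monomial k σ sign (codeword C v v∈) b [mod p ]
  codeword-monomial v w (v-rows , c , _ , v≡-c) (w-rows , d , _ , w≡-d) tr b =
    ≡-mod-rescale (sgn (sign b)) (w≡-d b zero) (v≡-c (τ b) (π b ⟨$⟩ʳ zero))
      (transports⇒monomial {v} {w} v-rows w-rows tr b zero)

  C⇒D : ∀ c → (C ∈C) c → (D ∈C) (monomial k σ sign c)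
  C⇒D c c∈C =
    respects-mod D (codeword D w w∈) (monomial k σ sign c)
                 (codeword-monomial v w v∈ w∈ tr) (codeword∈ D w w∈)
    where
    v w : Vect p k
    v = lift c
    w = map g (map f v)

    v∈ : InLA p k C v
    v∈ = lift∈LA C c∈C

    w∈ : InLA p k D w
    w∈ = into g _ (into f v v∈)

    tr : Transports pre v w
    tr = transports v (map f v) w v∈ (into f v v∈) (λ _ _ → refl) (λ _ _ → refl)

  D⇒C : ∀ d → (D ∈C) d → ∃ λ c → (C ∈C) c × (∀ i → monomial k σ sign c i ≡ d i [mod p ])
  D⇒C d d∈D =
    codeword C v v∈ , codeword∈ C v v∈ , λ b → ≡-mod-sym {a = d b} (codeword-monomial v w v∈ w∈ tr b)
    where
    w : Vect p k
    w = lift d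

    w∈ : InLA p k D w
    w∈ = lift∈LA D d∈D

    u-preimage : ∃ λ u → InLA p k D u × map g u ≈V w
    u-preimage = onto g w w∈

    u : Vect p k
    u = proj₁ u-preimage

    u∈ : InLA p k D u
    u∈ = proj₁ (proj₂ u-preimage)

    v-preimage : ∃ λ v → InLA p k C v × map f v ≈V u
    v-preimage = onto f u u∈

    v : Vect p k
    v = proj₁ v-preimage

    v∈ : InLA p k C v
    v∈ = proj₁ (proj₂ v-preimage)

    tr : Transports pre v w
    tr = transports v u w v∈ u∈ (λ b j → sym (proj₂ (proj₂ v-preimage) b j))
                               (λ b j → sym (proj₂ (proj₂ u-preimage) b j))

  codeIso : CodeIso p k C D
  codeIso = σ , sign , C⇒D , D⇒C

proposition3p4 : (p k : ℕ) → Prime p → (C D : Code p k) →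
                 SelfOrthogonal p k C → SelfOrthogonal p k D →
                 FrameTransitive p k D →
                 LatIso p k C D →
                 CodeIso p k C D
proposition3p4 0        _ ()
proposition3p4 1        _ ()
proposition3p4 (2+ q) k _ C D _ _ transitive f =
  let g , _ , hits = transitive (imageFrame f) (standardFrame D)
  in  Matching.codeIso f g (proj₁ ∘ hits) (proj₂ ∘ hits)
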